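{- Let $n\ge 3$ and let $P_n$ be the path with vertices $v_1,v_2,\dots,v_n$ in order. For every configuration of $2^{n-1}-1$ pebbles on $P_n$, there is a sequence of pebbling moves after which each of $v_2,v_3,\dots,v_{n-1}$ has at least one pebble, and additionally at least one of $v_1$, $v_n$ has at least one pebble.
   Context: A configuration of pebbles on a graph assigns a nonnegative integer number of pebbles to each vertex. A pebbling move consists of choosing adjacent vertices $u,v$ where $u$ has at least two pebbles, removing two pebbles from $u$ and adding one pebble to $v$. -}

module Defs where

open import Data.Nat using (ℕ; zero; suc; _+_; _∸_; _^_; _≤_; _<_; _≥_)
open import Data.Fin using (Fin; toℕ; _≟_)
open import Data.List using (List; map; allFin)
open import Data.Nat.ListAction using (sum)
open import Data.Product using (Σ; _×_; ∃; ∃-syntax; _,_)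
open import Data.Sum using (_⊎_)
open import Relation.Nullary using (yes; no)
open import Relation.Binary.PropositionalEquality using (_≡_)
open import Relation.Binary.Construct.Closure.ReflexiveTransitive using (Star)

Config : ℕ → Set
Config n = Fin n → ℕ

size : ∀ {n} → Config n → ℕ
size {n} c = sum (map c (allFin n))

-- Adjacency in the path P_n: vertex i (0-based, i.e. v_{i+1}) is adjacent to i±1.
PathAdj : ∀ {n} → Fin n → Fin n → Set
PathAdj u v = (suc (toℕ u) ≡ toℕ v) ⊎ (suc (toℕ v) ≡ toℕ u)

-- Pebbling move from u to v: u loses 2, v gains 1, others unchanged.
-- (u ≠ v is automatic for adjacent vertices.)
moveAt : ∀ {n} → Config n → Fin n → Fin n → Config n
moveAt c u v w with w ≟ u | w ≟ v
... | yes _ | _     = c w ∸ 2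
... | no _  | yes _ = suc (c w)
... | no _  | no _  = c w

data Step {n : ℕ} (c : Config n) : Config n → Set where
  move : (u v : Fin n) → PathAdj u v → 2 ≤ c u → Step c (moveAt c u v)

Reach : ∀ {n} → Config n → Config n → Set
Reach {n} = Star (Step {n})

{-# OPTIONS --safe #-}
module Submission where

-- The heart of the proof is a filling lemma for a segment v_lo, …, v_{lo+k} of the path: if it
-- carries at least (r + 1)·2^k − 1 pebbles (r ≥ 1), moves inside the segment put a pebble on each
-- of its first k vertices and r pebbles on its last one. By induction on k: if the last vertex has
-- t ≥ r pebbles, half of the surplus t − r is sent one step left, which leaves enough for the
-- shorter segment with r = 1; if t < r, the shorter segment is filled with 2(r − t) + 1 pebbles on
-- its last vertex and r − t of them are sent right.
--
-- If an end of P_n is empty, the lemma with r = 1 applies to the other n − 1 vertices. Otherwise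
-- both ends send half their pebbles into the interior v_2, …, v_{n−1}, one of them holding one
-- pebble back. The two choices of that end deliver s + t − 2 pebbles between them (s, t the loads of
-- the ends), so one of them brings the interior up to 2^{n−2} − 1 pebbles, enough for the lemma.

open import Defs
open import Data.Nat
  using (ℕ; zero; suc; _+_; _*_; _∸_; _^_; _≤_; _<_; _≥_; z≤n; s≤s; z<s; _≤?_; ⌊_/2⌋; ⌈_/2⌉)
open import Data.Nat.Properties hiding (_≟_)
open import Algebra.Properties.CommutativeSemigroup +-commutativeSemigroup using (xy∙z≈xz∙y)
open import Data.Nat.Tactic.RingSolver using (solve-∀)
open import Data.Nat.ListAction using (sum)
open import Data.Fin as Fin using (Fin; toℕ; fromℕ<; _≟_)
open import Data.Fin.Properties using (toℕ-fromℕ<)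
open import Data.List using (tabulate)
open import Data.List.Properties using (map-tabulate)
open import Data.Product using (∃-syntax; _×_; _,_; proj₁; proj₂)
open import Data.Sum using (_⊎_; inj₁; inj₂)
open import Function using (_∘_; id)
open import Relation.Nullary using (yes; no; contradiction)
open import Relation.Binary.PropositionalEquality
open import Relation.Binary.Construct.Closure.ReflexiveTransitive using (ε; _◅_; _◅◅_)

-- Vertices are addressed by natural numbers; past the end of the path the load reads as 0.
at : ∀ {n} → Config n → ℕ → ℕ
at {zero}  c _       = 0
at {suc n} c zero    = c Fin.zero
at {suc n} c (suc j) = at (c ∘ Fin.suc) j

at-toℕ : ∀ {n} (c : Config n) (i : Fin n) → at c (toℕ i) ≡ c i
at-toℕ c Fin.zero    = refl
at-toℕ c (Fin.suc i) = at-toℕ (c ∘ Fin.suc) i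

at-fromℕ< : ∀ {n j} (c : Config n) (j<n : j < n) → at c j ≡ c (fromℕ< j<n)
at-fromℕ< {suc n} {zero}  c _         = refl
at-fromℕ< {suc n} {suc j} c (s≤s j<n) = at-fromℕ< (c ∘ Fin.suc) j<n

at-cong : ∀ {n} {c d : Config n} j → (∀ i → toℕ i ≡ j → d i ≡ c i) → at d j ≡ at c j
at-cong {zero}  j       _  = refl
at-cong {suc n} zero    eq = eq Fin.zero refl
at-cong {suc n} (suc j) eq = at-cong j (λ i i≡j → eq (Fin.suc i) (cong suc i≡j))

segSum : (ℕ → ℕ) → ℕ → ℕ → ℕ
segSum g lo zero    = 0
segSum g lo (suc k) = segSum g lo k + g (lo + k)

segSum-cong : ∀ {g h : ℕ → ℕ} lo k → (∀ i → i < k → h (lo + i) ≡ g (lo + i)) →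
  segSum h lo k ≡ segSum g lo k
segSum-cong lo zero    _  = refl
segSum-cong lo (suc k) eq =
  cong₂ _+_ (segSum-cong lo k (λ i i<k → eq i (m<n⇒m<1+n i<k))) (eq k ≤-refl)

segSum-suc : ∀ g lo k → segSum g (suc lo) k ≡ segSum (g ∘ suc) lo k
segSum-suc g lo zero    = refl
segSum-suc g lo (suc k) = cong (_+ g (suc lo + k)) (segSum-suc g lo k)

segSum-cons : ∀ g lo k → segSum g lo (suc k) ≡ g lo + segSum g (suc lo) k
segSum-cons g lo zero    = trans (cong g (+-identityʳ lo)) (sym (+-identityʳ (g lo)))
segSum-cons g lo (suc k) = begin
  segSum g lo (suc k) + g (lo + suc k)         ≡⟨ cong₂ _+_ (segSum-cons g lo k) (cong g (+-suc lo k)) ⟩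
  g lo + segSum g (suc lo) k + g (suc lo + k)  ≡⟨ +-assoc (g lo) _ _ ⟩
  g lo + segSum g (suc lo) (suc k)             ∎
  where open ≡-Reasoning

segSum-bump : ∀ {g h : ℕ → ℕ} {lo k p q} → p < k → h (lo + p) ≡ g (lo + p) + q →
  (∀ i → i < k → i ≢ p → h (lo + i) ≡ g (lo + i)) → segSum h lo k ≡ segSum g lo k + q
segSum-bump {g} {h} {lo} {suc k} {p} {q} p<1+k bumped eq with m<1+n⇒m<n∨m≡n p<1+k
... | inj₁ p<k = begin
  segSum h lo k + h (lo + k)      ≡⟨ cong₂ _+_ (segSum-bump p<k bumped (λ i i<k → eq i (m<n⇒m<1+n i<k)))
                                               (eq k ≤-refl (>⇒≢ p<k)) ⟩
  segSum g lo k + q + g (lo + k)  ≡⟨ xy∙z≈xz∙y (segSum g lo k) q _ ⟩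
  segSum g lo (suc k) + q         ∎
  where open ≡-Reasoning
... | inj₂ refl = begin
  segSum h lo k + h (lo + k)        ≡⟨ cong₂ _+_ (segSum-cong lo k λ i i<k → eq i (m<n⇒m<1+n i<k) (<⇒≢ i<k))
                                                 bumped ⟩
  segSum g lo k + (g (lo + k) + q)  ≡⟨ +-assoc (segSum g lo k) _ q ⟨
  segSum g lo (suc k) + q           ∎
  where open ≡-Reasoning

sum-tabulate≡segSum : ∀ {n} (c : Config n) → sum (tabulate c) ≡ segSum (at c) 0 n
sum-tabulate≡segSum {zero}  c = refl
sum-tabulate≡segSum {suc n} c = begin
  c Fin.zero + sum (tabulate (c ∘ Fin.suc))   ≡⟨ cong (c Fin.zero +_) (sum-tabulate≡segSum (c ∘ Fin.suc)) ⟩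
  c Fin.zero + segSum (at (c ∘ Fin.suc)) 0 n  ≡⟨ cong (c Fin.zero +_) (segSum-suc (at c) 0 n) ⟨
  at c 0 + segSum (at c) 1 n                  ≡⟨ segSum-cons (at c) 0 n ⟨
  segSum (at c) 0 (suc n)                     ∎
  where open ≡-Reasoning

size≡segSum : ∀ {n} (c : Config n) → size c ≡ segSum (at c) 0 n
size≡segSum c = trans (cong sum (map-tabulate id c)) (sum-tabulate≡segSum c)

Adjacent : ℕ → ℕ → Set
Adjacent a b = suc a ≡ b ⊎ suc b ≡ a

adjacent⇒≢ : ∀ {a b} → Adjacent a b → b ≢ a
adjacent⇒≢ (inj₁ eq) refl = 1+n≢n eq
adjacent⇒≢ (inj₂ eq) refl = 1+n≢n eq

moveAt-source : ∀ {n} (c : Config n) u v → moveAt c u v u ≡ c u ∸ 2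
moveAt-source c u v with u ≟ u
... | yes _  = refl
... | no u≢u = contradiction refl u≢u

moveAt-target : ∀ {n} (c : Config n) u v → v ≢ u → moveAt c u v v ≡ suc (c v)
moveAt-target c u v v≢u with v ≟ u | v ≟ v
... | yes v≡u | _      = contradiction v≡u v≢u
... | no _    | yes _  = refl
... | no _    | no v≢v = contradiction refl v≢v

moveAt-other : ∀ {n} (c : Config n) u v w → w ≢ u → w ≢ v → moveAt c u v w ≡ c w
moveAt-other c u v w w≢u w≢v with w ≟ u | w ≟ v
... | yes w≡u | _       = contradiction w≡u w≢u
... | no _    | yes w≡v = contradiction w≡v w≢v
... | no _    | no _    = refl

record Transfer {n} (c : Config n) (a b q : ℕ) : Set where
  field
    config : Config n
    reach  : Reach c config
    source : at config a + (q + q) ≡ at c a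
    target : at config b ≡ at c b + q
    others : ∀ j → j ≢ a → j ≢ b → at config j ≡ at c j
open Transfer

m+n≡o⇒k+n≤o⇒k≤m : ∀ {k m n o} → m + n ≡ o → k + n ≤ o → k ≤ m
m+n≡o⇒k+n≤o⇒k≤m {k} {m} {n} m+n≡o k+n≤o = +-cancelʳ-≤ n k m (subst (k + n ≤_) (sym m+n≡o) k+n≤o)

single-move : ∀ {n a b} (c : Config n) → a < n → b < n → Adjacent a b → 2 ≤ at c a → Transfer c a b 1
single-move {n} {a} {b} c a<n b<n adj 2≤ca = record
  { config = moveAt c u v
  ; reach  = move u v (subst₂ Adjacent (sym (toℕ-fromℕ< a<n)) (sym (toℕ-fromℕ< b<n)) adj) 2≤cu ◅ ε
  ; source = begin
      at (moveAt c u v) a + 2  ≡⟨ cong (_+ 2) (trans (at-fromℕ< _ a<n) (moveAt-source c u v)) ⟩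
      c u ∸ 2 + 2              ≡⟨ m∸n+n≡m 2≤cu ⟩
      c u                      ≡⟨ at-fromℕ< c a<n ⟨
      at c a                   ∎
  ; target = begin
      at (moveAt c u v) b      ≡⟨ trans (at-fromℕ< _ b<n) (moveAt-target c u v v≢u) ⟩
      suc (c v)                ≡⟨ cong suc (at-fromℕ< c b<n) ⟨
      suc (at c b)             ≡⟨ +-comm 1 (at c b) ⟩
      at c b + 1               ∎
  ; others = λ j j≢a j≢b → at-cong j λ i i≡j →
      moveAt-other c u v i (j≢a ∘ trans (sym i≡j) ∘ toℕ-≡ a<n) (j≢b ∘ trans (sym i≡j) ∘ toℕ-≡ b<n)
  }
  where
  open ≡-Reasoning
  u = fromℕ< a<n
  v = fromℕ< b<n
  toℕ-≡ : ∀ {x i} (x<n : x < n) → i ≡ fromℕ< x<n → toℕ i ≡ x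
  toℕ-≡ x<n refl = toℕ-fromℕ< x<n
  2≤cu : 2 ≤ c u
  2≤cu = subst (2 ≤_) (at-fromℕ< c a<n) 2≤ca
  v≢u : v ≢ u
  v≢u v≡u = adjacent⇒≢ adj (trans (sym (toℕ-fromℕ< b<n)) (trans (cong toℕ v≡u) (toℕ-fromℕ< a<n)))

transfer-trans : ∀ {n a b p q} {c : Config n} (T : Transfer c a b p) → Transfer (config T) a b q →
  Transfer c a b (p + q)
transfer-trans {a = a} {b} {p} {q} {c} T U = record
  { config = config U
  ; reach  = reach T ◅◅ reach U
  ; source = begin
      at (config U) a + ((p + q) + (p + q))  ≡⟨ regroup (at (config U) a) p q ⟩
      at (config U) a + (q + q) + (p + p)    ≡⟨ cong (_+ (p + p)) (source U) ⟩
      at (config T) a + (p + p)              ≡⟨ source T ⟩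
      at c a                                 ∎
  ; target = trans (target U) (trans (cong (_+ q) (target T)) (+-assoc (at c b) p q))
  ; others = λ j j≢a j≢b → trans (others U j j≢a j≢b) (others T j j≢a j≢b)
  }
  where
  open ≡-Reasoning
  regroup : ∀ x p q → x + ((p + q) + (p + q)) ≡ x + (q + q) + (p + p)
  regroup = solve-∀

transfer : ∀ {n a b} q (c : Config n) → a < n → b < n → Adjacent a b → q + q ≤ at c a → Transfer c a b q
transfer zero c _ _ _ _ = record
  { config = c ; reach = ε ; source = +-identityʳ _ ; target = sym (+-identityʳ _) ; others = λ _ _ _ → refl }
transfer {a = a} {b} (suc q) c a<n b<n adj enough =
  transfer-trans first (transfer q (config first) a<n b<n adj (m+n≡o⇒k+n≤o⇒k≤m (source first) enough′))
  where
  double-suc : ∀ q → q + q + 2 ≡ suc q + suc q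
  double-suc = solve-∀
  enough′ : q + q + 2 ≤ at c a
  enough′ = ≤-trans (≤-reflexive (double-suc q)) enough
  first : Transfer c a b 1
  first = single-move c a<n b<n adj (≤-trans (m≤n+m 2 (q + q)) enough′)

⌊n/2⌋+⌊n/2⌋≤n : ∀ n → ⌊ n /2⌋ + ⌊ n /2⌋ ≤ n
⌊n/2⌋+⌊n/2⌋≤n n =
  ≤-trans (+-monoʳ-≤ ⌊ n /2⌋ (⌊n/2⌋≤⌈n/2⌉ n)) (≤-reflexive (⌊n/2⌋+⌈n/2⌉≡n n))

n≤1+⌊n/2⌋+⌊n/2⌋ : ∀ n → n ≤ suc (⌊ n /2⌋ + ⌊ n /2⌋)
n≤1+⌊n/2⌋+⌊n/2⌋ n = begin
  n                        ≡⟨ ⌊n/2⌋+⌈n/2⌉≡n n ⟨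
  ⌊ n /2⌋ + ⌈ n /2⌉        ≤⟨ +-monoʳ-≤ ⌊ n /2⌋ (⌊n/2⌋-mono (n≤1+n (suc n))) ⟩
  ⌊ n /2⌋ + suc ⌊ n /2⌋    ≡⟨ +-suc ⌊ n /2⌋ ⌊ n /2⌋ ⟩
  suc (⌊ n /2⌋ + ⌊ n /2⌋)  ∎
  where open ≤-Reasoning

surplus-bound : ∀ P S {r m q} → 1 ≤ r → (1 + r) * (2 * P) ≤ suc (S + (r + m)) → m ≤ suc (q + q) →
  2 * P ≤ suc (S + q)
surplus-bound zero        _ _ _ _ = z≤n
surplus-bound P@(suc _) S {suc r} {m} {q} _ enough m≤ = begin
  2 * P                            ≡⟨ n≡⌊n+n/2⌋ (2 * P) ⟩
  ⌊ 2 * P + 2 * P /2⌋              ≤⟨ ⌊n/2⌋-mono doubled ⟩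
  ⌈ suc (S + q) + suc (S + q) /2⌉  ≡⟨ n≡⌈n+n/2⌉ (suc (S + q)) ⟨
  suc (S + q)                      ∎
  where
  open ≤-Reasoning
  expand : ∀ P r → 2 * P + 2 * P + r * (2 * P) ≡ (2 + r) * (2 * P)
  expand = solve-∀
  regroup : ∀ S r q → suc (S + (suc r + suc (q + q))) + S ≡ suc (suc (S + q) + suc (S + q)) + r
  regroup = solve-∀
  doubled : 2 * P + 2 * P ≤ suc (suc (S + q) + suc (S + q))
  doubled = +-cancelʳ-≤ r _ _ (begin
    2 * P + 2 * P + r                    ≤⟨ +-monoʳ-≤ (2 * P + 2 * P) (m≤m*n r (2 * P)) ⟩
    2 * P + 2 * P + r * (2 * P)          ≡⟨ expand P r ⟩
    (2 + r) * (2 * P)                    ≤⟨ enough ⟩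
    suc (S + (suc r + m))                ≤⟨ s≤s (+-monoʳ-≤ S (+-monoʳ-≤ (suc r) m≤)) ⟩
    suc (S + (suc r + suc (q + q)))      ≤⟨ m≤m+n _ S ⟩
    suc (S + (suc r + suc (q + q))) + S  ≡⟨ regroup S r q ⟩
    suc (suc (S + q) + suc (S + q)) + r  ∎)

deficit-bound : ∀ P S t u → (1 + (t + u)) * (2 * P) ≤ suc (S + t) → (1 + suc (u + u)) * P ≤ suc S
deficit-bound zero        _ _ u _      = ≤-trans (≤-reflexive (*-zeroʳ (2 + (u + u)))) z≤n
deficit-bound P@(suc _) S t u enough = +-cancelʳ-≤ t _ _ (begin
  (1 + suc (u + u)) * P + t            ≤⟨ +-monoʳ-≤ _ (m≤m*n t (2 * P)) ⟩
  (1 + suc (u + u)) * P + t * (2 * P)  ≡⟨ regroup P t u ⟩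
  (1 + (t + u)) * (2 * P)              ≤⟨ enough ⟩
  suc (S + t)                          ∎)
  where
  open ≤-Reasoning
  regroup : ∀ P t u → (2 + (u + u)) * P + t * (2 * P) ≡ (1 + (t + u)) * (2 * P)
  regroup = solve-∀

all<-suc : ∀ {P : ℕ → Set} {k} → (∀ i → i < k → P i) → P k → ∀ i → i < suc k → P i
all<-suc below atk i i<1+k with m<1+n⇒m<n∨m≡n i<1+k
... | inj₁ i<k  = below i i<k
... | inj₂ refl = atk

Outside : ℕ → ℕ → ℕ → Set
Outside lo hi j = j < lo ⊎ hi < j

outside-suc : ∀ {lo k j} → Outside lo (lo + suc k) j → Outside lo (lo + k) j × j ≢ lo + k × j ≢ lo + suc k
outside-suc {lo} {k} (inj₁ j<lo) =
  inj₁ j<lo , <⇒≢ (<-≤-trans j<lo (m≤m+n lo k)) , <⇒≢ (<-≤-trans j<lo (m≤m+n lo (suc k)))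
outside-suc {lo} {k} {j} (inj₂ e<j) =
  inj₂ b<j , >⇒≢ b<j , >⇒≢ e<j
  where
  b<j : lo + k < j
  b<j = <-trans (+-monoʳ-< lo (n<1+n k)) e<j

record Filled {n} (c : Config n) (lo k r : ℕ) : Set where
  field
    config  : Config n
    reach   : Reach c config
    covered : ∀ i → i < k → 1 ≤ at config (lo + i)
    loaded  : r ≤ at config (lo + k)
    outside : ∀ j → Outside lo (lo + k) j → at config j ≡ at c j
open Filled

fill : ∀ {n} k lo r (c : Config n) → lo + k < n → 1 ≤ r →
  (1 + r) * 2 ^ k ≤ suc (segSum (at c) lo (suc k)) → Filled c lo k r
fill-surplus : ∀ {n} k lo r (c : Config n) → lo + suc k < n → 1 ≤ r →
  (1 + r) * 2 ^ suc k ≤ suc (segSum (at c) lo (2 + k)) → r ≤ at c (lo + suc k) → Filled c lo (suc k) r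
fill-deficit : ∀ {n} k lo r (c : Config n) → lo + suc k < n →
  (1 + r) * 2 ^ suc k ≤ suc (segSum (at c) lo (2 + k)) → at c (lo + suc k) < r → Filled c lo (suc k) r

fill zero lo r c _ _ enough = record
  { config = c ; reach = ε ; covered = λ _ () ; outside = λ _ _ → refl
  ; loaded = ≤-pred (subst (_≤ suc (at c (lo + 0))) (*-identityʳ (suc r)) enough)
  }
fill (suc k) lo r c e<n 1≤r enough with r ≤? at c (lo + suc k)
... | yes r≤t = fill-surplus k lo r c e<n 1≤r enough r≤t
... | no  r≰t = fill-deficit k lo r c e<n enough (≰⇒> r≰t)

fill-surplus k lo r c e<n 1≤r enough r≤t = record
  { config  = config F
  ; reach   = reach T ◅◅ reach F
  ; covered = all<-suc (covered F) (loaded F)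
  ; loaded  = subst (r ≤_) (sym (outside F e (inj₂ b<e))) (m+n≡o⇒k+n≤o⇒k≤m (source T) r+2q≤t)
  ; outside = λ j o → let o′ , j≢b , j≢e = outside-suc o in trans (outside F j o′) (others T j j≢e j≢b)
  }
  where
  b = lo + k
  e = lo + suc k
  b<e : b < e
  b<e = +-monoʳ-< lo (n<1+n k)
  S = segSum (at c) lo (suc k)
  m = at c e ∸ r
  q = ⌊ m /2⌋
  r+2q≤t : r + (q + q) ≤ at c e
  r+2q≤t = subst (r + (q + q) ≤_) (m+[n∸m]≡n r≤t) (+-monoʳ-≤ r (⌊n/2⌋+⌊n/2⌋≤n m))
  T : Transfer c e b q
  T = transfer q c e<n (<-trans b<e e<n) (inj₂ (sym (+-suc lo k)))
        (≤-trans (⌊n/2⌋+⌊n/2⌋≤n m) (m∸n≤m _ r))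
  bumped : segSum (at (config T)) lo (suc k) ≡ S + q
  bumped = segSum-bump (n<1+n k) (target T) λ i i<1+k i≢k →
    others T (lo + i) (<⇒≢ (+-monoʳ-< lo i<1+k)) (i≢k ∘ +-cancelˡ-≡ lo i k)
  enough′ : (1 + r) * (2 * 2 ^ k) ≤ suc (S + (r + m))
  enough′ = subst (λ t → (1 + r) * (2 * 2 ^ k) ≤ suc (S + t)) (sym (m+[n∸m]≡n r≤t)) enough
  F : Filled (config T) lo k 1
  F = fill k lo 1 (config T) (<-trans b<e e<n) ≤-refl (subst (λ x → 2 * 2 ^ k ≤ suc x) (sym bumped)
        (surplus-bound (2 ^ k) S 1≤r enough′ (n≤1+⌊n/2⌋+⌊n/2⌋ m)))

fill-deficit k lo r c e<n enough t<r = record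
  { config  = config T
  ; reach   = reach F ◅◅ reach T
  ; covered = all<-suc (λ i i<k → subst (1 ≤_) (sym (untouched i i<k)) (covered F i i<k))
                       (m+n≡o⇒k+n≤o⇒k≤m (source T) (loaded F))
  ; loaded  = ≤-reflexive (sym (begin
      at (config T) e      ≡⟨ target T ⟩
      at (config F) e + u  ≡⟨ cong (_+ u) (outside F e (inj₂ b<e)) ⟩
      at c e + u           ≡⟨ m+[n∸m]≡n (<⇒≤ t<r) ⟩
      r                    ∎))
  ; outside = λ j o → let o′ , j≢b , j≢e = outside-suc o in trans (others T j j≢b j≢e) (outside F j o′)
  }
  where
  open ≡-Reasoning
  b = lo + k
  e = lo + suc k
  b<e : b < e
  b<e = +-monoʳ-< lo (n<1+n k)
  S = segSum (at c) lo (suc k)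
  u = r ∸ at c e
  enough′ : (1 + (at c e + u)) * (2 * 2 ^ k) ≤ suc (S + at c e)
  enough′ = subst (λ x → (1 + x) * (2 * 2 ^ k) ≤ suc (S + at c e)) (sym (m+[n∸m]≡n (<⇒≤ t<r))) enough
  F : Filled c lo k (suc (u + u))
  F = fill k lo (suc (u + u)) c (<-trans b<e e<n) (s≤s z≤n) (deficit-bound (2 ^ k) S (at c e) u enough′)
  T : Transfer (config F) b e u
  T = transfer u (config F) (<-trans b<e e<n) e<n (inj₁ (sym (+-suc lo k))) (≤-trans (n≤1+n _) (loaded F))
  untouched : ∀ i → i < k → at (config T) (lo + i) ≡ at (config F) (lo + i)
  untouched i i<k = others T (lo + i) (<⇒≢ (+-monoʳ-< lo i<k)) (<⇒≢ (+-monoʳ-< lo (m<n⇒m<1+n i<k)))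

fill-interior : ∀ m (c : Config (3 + m)) q₁ q₂ → q₁ + q₁ ≤ at c 0 → q₂ + q₂ ≤ at c (2 + m) →
  2 * 2 ^ m ≤ suc (segSum (at c) 1 (suc m) + q₁ + q₂) →
  ∃[ d ] (Reach c d × (∀ i → i < suc m → 1 ≤ at d (suc i))
         × at d 0 + (q₁ + q₁) ≡ at c 0 × at d (2 + m) + (q₂ + q₂) ≡ at c (2 + m))
fill-interior m c q₁ q₂ enough₁ enough₂ enough =
  config F , reach T₁ ◅◅ reach T₂ ◅◅ reach F , all<-suc (covered F) (loaded F) , left , right
  where
  T₁ : Transfer c 0 1 q₁
  T₁ = transfer q₁ c (s≤s z≤n) (s≤s (s≤s z≤n)) (inj₁ refl) enough₁
  T₂ : Transfer (config T₁) (2 + m) (1 + m) q₂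
  T₂ = transfer q₂ (config T₁) ≤-refl (n≤1+n _) (inj₂ refl)
         (subst (q₂ + q₂ ≤_) (sym (others T₁ (2 + m) (λ ()) (λ ()))) enough₂)
  bumped₁ : segSum (at (config T₁)) 1 (suc m) ≡ segSum (at c) 1 (suc m) + q₁
  bumped₁ = segSum-bump {lo = 1} {suc m} (s≤s z≤n) (target T₁) λ i _ i≢0 →
    others T₁ (suc i) (λ ()) (i≢0 ∘ suc-injective)
  bumped₂ : segSum (at (config T₂)) 1 (suc m) ≡ segSum (at (config T₁)) 1 (suc m) + q₂
  bumped₂ = segSum-bump {lo = 1} {suc m} ≤-refl (target T₂) λ i i<1+m i≢m →
    others T₂ (suc i) (<⇒≢ (s≤s i<1+m)) (i≢m ∘ suc-injective)
  F : Filled (config T₂) 1 m 1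
  F = fill m 1 1 (config T₂) (n≤1+n _) ≤-refl
        (subst (λ x → 2 * 2 ^ m ≤ suc x) (sym (trans bumped₂ (cong (_+ q₂) bumped₁))) enough)
  left : at (config F) 0 + (q₁ + q₁) ≡ at c 0
  left = trans (cong (_+ (q₁ + q₁)) (trans (outside F 0 (inj₁ (s≤s z≤n))) (others T₂ 0 (λ ()) (λ ()))))
               (source T₁)
  right : at (config F) (2 + m) + (q₂ + q₂) ≡ at c (2 + m)
  right = trans (cong (_+ (q₂ + q₂)) (outside F (2 + m) (inj₂ ≤-refl)))
                (trans (source T₂) (others T₁ (2 + m) (λ ()) (λ ())))

halves-complement : ∀ P M {a₁ a₂ b₁ b₂} → suc (suc (a₁ + a₂) + M + suc (b₁ + b₂)) ≡ 2 * (2 * P) →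
  suc (M + a₁ + b₂) < 2 * P → 2 * P ≤ suc (M + a₂ + b₁)
halves-complement P M {a₁} {a₂} {b₁} {b₂} total short =
  +-cancelˡ-≤ (suc (suc (M + a₁ + b₂))) _ _ (begin
    suc (suc (M + a₁ + b₂)) + 2 * P              ≤⟨ +-monoˡ-≤ (2 * P) short ⟩
    2 * P + 2 * P                                ≡⟨ double P ⟩
    2 * (2 * P)                                  ≡⟨ total ⟨
    suc (suc (a₁ + a₂) + M + suc (b₁ + b₂))      ≤⟨ m≤m+n _ M ⟩
    suc (suc (a₁ + a₂) + M + suc (b₁ + b₂)) + M  ≡⟨ regroup M a₁ a₂ b₁ b₂ ⟩
    suc (suc (M + a₁ + b₂)) + suc (M + a₂ + b₁)  ∎)
  where
  open ≤-Reasoning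
  double : ∀ P → 2 * P + 2 * P ≡ 2 * (2 * P)
  double = solve-∀
  regroup : ∀ M a₁ a₂ b₁ b₂ →
    suc (suc (a₁ + a₂) + M + suc (b₁ + b₂)) + M ≡ suc (suc (M + a₁ + b₂)) + suc (M + a₂ + b₁)
  regroup = solve-∀

halves-choice : ∀ P M s t → suc (suc s + M + suc t) ≡ 2 * (2 * P) →
  2 * P ≤ suc (M + ⌊ s /2⌋ + ⌈ t /2⌉) ⊎ 2 * P ≤ suc (M + ⌈ s /2⌉ + ⌊ t /2⌋)
halves-choice P M s t total with 2 * P ≤? suc (M + ⌊ s /2⌋ + ⌈ t /2⌉)
... | yes enough = inj₁ enough
... | no  short  = inj₂ (halves-complement P M total′ (≰⇒> short))
  where
  total′ : suc (suc (⌊ s /2⌋ + ⌈ s /2⌉) + M + suc (⌊ t /2⌋ + ⌈ t /2⌉)) ≡ 2 * (2 * P)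
  total′ rewrite ⌊n/2⌋+⌈n/2⌉≡n s | ⌊n/2⌋+⌈n/2⌉≡n t = total

Pebbled : ∀ m → Config (3 + m) → Set
Pebbled m d = (∀ i → i < suc m → 1 ≤ at d (suc i)) × (1 ≤ at d 0 ⊎ 1 ≤ at d (2 + m))

pebble-from-right : ∀ m (c : Config (3 + m)) → 2 ^ (2 + m) ≤ suc (segSum (at c) 1 (2 + m)) →
  ∃[ d ] (Reach c d × Pebbled m d)
pebble-from-right m c enough = config F , reach F , covered F , inj₂ (loaded F)
  where
  F : Filled c 1 (suc m) 1
  F = fill (suc m) 1 1 c ≤-refl ≤-refl enough

pebble-from-left : ∀ m (c : Config (3 + m)) → 2 ^ (2 + m) ≤ suc (segSum (at c) 0 (2 + m)) →
  ∃[ d ] (Reach c d × Pebbled m d)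
pebble-from-left m c enough =
  config F , reach F , all<-suc (λ i i<m → covered F (suc i) (s≤s i<m)) (loaded F) , inj₁ (covered F 0 z<s)
  where
  F : Filled c 0 (suc m) 1
  F = fill (suc m) 0 1 c (n≤1+n _) ≤-refl enough

pebble-both-ends : ∀ m (c : Config (3 + m)) {s t} → at c 0 ≡ suc s → at c (2 + m) ≡ suc t →
  suc (suc s + segSum (at c) 1 (suc m) + suc t) ≡ 2 ^ (2 + m) → ∃[ d ] (Reach c d × Pebbled m d)
pebble-both-ends m c {s} {t} s≡ t≡ total with halves-choice (2 ^ m) (segSum (at c) 1 (suc m)) s t total
... | inj₁ enough =
  let d , c↠d , interior , left , _ = fill-interior m c ⌊ s /2⌋ ⌈ t /2⌉
        (≤-trans (m≤n⇒m≤1+n (⌊n/2⌋+⌊n/2⌋≤n s)) (≤-reflexive (sym s≡)))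
        (≤-trans (⌊n/2⌋+⌊n/2⌋≤n (suc t)) (≤-reflexive (sym t≡))) enough
  in d , c↠d , interior , inj₁ (m+n≡o⇒k+n≤o⇒k≤m (trans left s≡) (s≤s (⌊n/2⌋+⌊n/2⌋≤n s)))
... | inj₂ enough =
  let d , c↠d , interior , _ , right = fill-interior m c ⌈ s /2⌉ ⌊ t /2⌋
        (≤-trans (⌊n/2⌋+⌊n/2⌋≤n (suc s)) (≤-reflexive (sym s≡)))
        (≤-trans (m≤n⇒m≤1+n (⌊n/2⌋+⌊n/2⌋≤n t)) (≤-reflexive (sym t≡))) enough
  in d , c↠d , interior , inj₂ (m+n≡o⇒k+n≤o⇒k≤m (trans right t≡) (s≤s (⌊n/2⌋+⌊n/2⌋≤n t)))

pebble : ∀ m (c : Config (3 + m)) → suc (at c 0 + segSum (at c) 1 (suc m) + at c (2 + m)) ≡ 2 ^ (2 + m) →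
  ∃[ d ] (Reach c d × Pebbled m d)
pebble m c total with at c 0 in s≡
... | zero  = pebble-from-right m c (≤-reflexive (sym total))
... | suc s with at c (2 + m) in t≡
...   | suc t = pebble-both-ends m c s≡ t≡ total
...   | zero  = pebble-from-left m c (≤-reflexive (begin
  2 ^ (2 + m)                                ≡⟨ total ⟨
  suc (suc s + segSum (at c) 1 (suc m) + 0)  ≡⟨ cong suc (+-identityʳ _) ⟩
  suc (suc s + segSum (at c) 1 (suc m))      ≡⟨ cong (λ x → suc (x + segSum (at c) 1 (suc m))) s≡ ⟨
  suc (at c 0 + segSum (at c) 1 (suc m))     ≡⟨ cong suc (segSum-cons (at c) 0 (suc m)) ⟨
  suc (segSum (at c) 0 (2 + m))              ∎))
  where open ≡-Reasoning

pebbled⇒goal : ∀ {m} {d : Config (3 + m)} → Pebbled m d →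
  ((i : Fin (3 + m)) → 0 < toℕ i → suc (toℕ i) < 3 + m → 1 ≤ d i)
  × (∃[ i ] (toℕ i ≡ 0 × 1 ≤ d i) ⊎ ∃[ i ] (suc (toℕ i) ≡ 3 + m × 1 ≤ d i))
pebbled⇒goal {d = d} (interior , _) .proj₁ (Fin.suc i) _ (s≤s (s≤s i<1+m)) =
  subst (1 ≤_) (at-toℕ d (Fin.suc i)) (interior (toℕ i) i<1+m)
pebbled⇒goal (_ , inj₁ 1≤d₀) .proj₂ = inj₁ (Fin.zero , refl , 1≤d₀)
pebbled⇒goal {d = d} (_ , inj₂ 1≤dₑ) .proj₂ =
  inj₂ (fromℕ< ≤-refl , cong suc (toℕ-fromℕ< ≤-refl) , subst (1 ≤_) (at-fromℕ< d ≤-refl) 1≤dₑ)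

mainTheorem2 : (n : ℕ) → n ≥ 3 → (c : Config n) → size c ≡ 2 ^ (n ∸ 1) ∸ 1 →
    ∃[ d ] (Reach c d
      × ((i : Fin n) → 0 < toℕ i → suc (toℕ i) < n → 1 ≤ d i)
      × (∃[ i ] (toℕ i ≡ 0 × 1 ≤ d i) ⊎ ∃[ i ] (suc (toℕ i) ≡ n × 1 ≤ d i)))
mainTheorem2 (suc (suc (suc m))) (s≤s (s≤s (s≤s z≤n))) c size≡ =
  let d , c↠d , pebbled = pebble m c total in d , c↠d , pebbled⇒goal pebbled
  where
  open ≡-Reasoning
  total : suc (at c 0 + segSum (at c) 1 (suc m) + at c (2 + m)) ≡ 2 ^ (2 + m)
  total = begin
    suc (at c 0 + segSum (at c) 1 (suc m) + at c (2 + m))  ≡⟨ cong (λ x → suc (x + at c (2 + m)))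
                                                                (segSum-cons (at c) 0 (suc m)) ⟨
    suc (segSum (at c) 0 (3 + m))                          ≡⟨ cong suc (size≡segSum c) ⟨
    suc (size c)                                           ≡⟨ cong suc size≡ ⟩
    suc (2 ^ (2 + m) ∸ 1)                                  ≡⟨ m+[n∸m]≡n (m^n>0 2 (2 + m)) ⟩
    2 ^ (2 + m)                                            ∎
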